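{- In the quasi-consecutive pattern poset, if a permutation $\tau$ covers precisely one permutation, then for every $\sigma\le\tau$ the interval $[\sigma,\tau]=\{\rho:\sigma\le\rho\le\tau\}$ is a chain.
   Context: Permutations are written in one-line notation. For permutations $\sigma$ of length $m$ and $\tau=a_1a_2\cdots a_n$ of length $n$, an occurrence of $\sigma$ in $\tau$ (as a quasi-consecutive pattern) is a sequence of positions $1\le i_1<i_2<\cdots<i_m\le n$ such that $i_{j+1}=i_j+1$ for all $2\le j\le m-1$ and $a_{i_1}\cdots a_{i_m}$ is order-isomorphic to $\sigma$; thus all entries of the occurrence are adjacent in $\tau$ except possibly the first and second. The quasi-consecutive pattern poset is the set of all finite permutations ordered by $\sigma\le\tau$ iff $\tau$ contains an occurrence of $\sigma$. $\tau$ covers $\rho$ if $\rho<\tau$ and no $\alpha$ satisfies $\rho<\alpha<\tau$ (equivalently, $\rho\le\tau$ and $\rho$ has length one less than $\tau$). -}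

module Defs where

open import Data.Nat using (ℕ; zero; suc; _≤_)
open import Data.Fin using (Fin; toℕ; _<_)
open import Data.Product using (Σ; ∃; ∃-syntax; _×_; _,_)
open import Data.Sum using (_⊎_)
open import Function.Definitions using (Injective)
open import Relation.Binary.PropositionalEquality using (_≡_)
open import Relation.Nullary using (¬_)
open import Function.Bundles using (_⇔_)

-- A permutation of length len in one-line notation: an injective
-- (hence bijective) map  Fin len → Fin len,  i ↦ a_{i+1} - 1.
record Perm : Set where
  constructor perm
  field
    len   : ℕ
    val   : Fin len → Fin len
    inj   : Injective _≡_ _≡_ val
open Perm public

_≈_ : Perm → Perm → Set
σ ≈ τ = Σ (len σ ≡ len τ) λ _ → ∀ (i : Fin (len σ)) (j : Fin (len τ)) →
          toℕ i ≡ toℕ j → toℕ (val σ i) ≡ toℕ (val τ j)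

-- An occurrence of σ in τ as a quasi-consecutive pattern:
-- strictly increasing positions e, all adjacent except possibly the first two
-- (0-indexed: for k ≥ 1, position k+1 is right after position k),
-- and the subsequence is order-isomorphic to σ.
record Occurrence (σ τ : Perm) : Set where
  field
    pos     : Fin (len σ) → Fin (len τ)
    incr    : ∀ i j → i < j → pos i < pos j
    quasi   : ∀ (i j : Fin (len σ)) → 1 ≤ toℕ i → toℕ j ≡ suc (toℕ i) →
                toℕ (pos j) ≡ suc (toℕ (pos i))
    orderIso : ∀ i j → (val σ i < val σ j) ⇔ (val τ (pos i) < val τ (pos j))

_≼_ : Perm → Perm → Set
σ ≼ τ = Occurrence σ τ

_≺_ : Perm → Perm → Set
σ ≺ τ = σ ≼ τ × ¬ (τ ≼ σ)

Covers : Perm → Perm → Set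
Covers τ ρ = ρ ≺ τ × ¬ (∃[ α ] (ρ ≺ α × α ≺ τ))

CoversExactlyOne : Perm → Set
CoversExactlyOne τ = ∃[ ρ ] (Covers τ ρ × (∀ ρ' → Covers τ ρ' → ρ' ≈ ρ))

InInterval : Perm → Perm → Perm → Set
InInterval σ τ ρ = σ ≼ ρ × ρ ≼ τ

IsChain : Perm → Perm → Set
IsChain σ τ = ∀ ρ₁ ρ₂ → InInterval σ τ ρ₁ → InInterval σ τ ρ₂ → (ρ₁ ≼ ρ₂) ⊎ (ρ₂ ≼ ρ₁)

module Submission where

-- If τ covers exactly one permutation, then τ is monotone (increasing or
-- decreasing).  Patterns of a monotone permutation are monotone in the same
-- direction, and such permutations are comparable (the shorter is a prefix
-- of the longer), so everything below τ forms a chain.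
--
-- τ = t₀ t₁ ⋯ tₘ is monotone because deleting its first or its last letter
-- gives two consecutive patterns of length m, both covered by τ.  By
-- uniqueness of the cover their standardisations coincide, which says
--   t(i) < t(j)  ⇒  t(i+1) < t(j+1)      (shift invariance),
-- and shift invariance propagates the comparison of t₀, t₁ along the word.

open import Defs
open import Data.Nat as ℕ using (ℕ; zero; suc; _+_; _∸_; _≤_; z≤n; s≤s)
import Data.Nat.Properties as ℕP
open import Data.Fin using (Fin; zero; suc; toℕ; fromℕ<; inject₁; inject≤; opposite; cast; _<_)
open import Data.Fin.Properties
  using (toℕ-injective; toℕ-fromℕ<; toℕ-inject≤; toℕ-inject₁; toℕ-cast; toℕ<n; <-cmp; <-irrefl; <-asym; <-trans;
         injective⇒≤; suc-injective; inject₁-injective; opposite-prop; opposite-involutive)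
open import Data.Fin.Subset using (Subset; _∈_; _⊂_; ⊤; ∣_∣)
open import Data.Fin.Subset.Properties using (p⊂q⇒∣p∣<∣q∣; ∣⊤∣≡n; ∈⊤)
open import Data.Vec using (tabulate)
open import Data.Vec.Properties using (lookup∘tabulate; []=⇒lookup; lookup⇒[]=)
open import Data.Bool.Properties using (T-≡)
open import Data.Empty using (⊥-elim)
open import Data.Product using (Σ; ∃-syntax; _×_; _,_)
open import Data.Sum using (_⊎_; inj₁; inj₂)
open import Function using (_∘_)
open import Function.Bundles using (_⇔_; mk⇔; Equivalence)
import Function.Properties.Equivalence as ⇔
open import Function.Definitions using (Injective)
open import Relation.Binary using (tri<; tri≈; tri>)
open import Relation.Binary.PropositionalEquality
open import Relation.Nullary using (¬_; contradiction)

open Equivalence using (to; from)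

Increasing : ∀ {a b} → (Fin a → Fin b) → Set
Increasing f = ∀ i j → i < j → f i < f j

module Standardisation {m k : ℕ} (g : Fin m → Fin k) (g-inj : Injective _≡_ _≡_ g) where

  below : Fin m → Subset m
  below i = tabulate (λ j → toℕ (g j) ℕ.<ᵇ toℕ (g i))

  below-sound : ∀ {i j} → j ∈ below i → g j < g i
  below-sound {i} {j} j∈ =
    ℕP.<ᵇ⇒< _ _ (from T-≡ (trans (sym (lookup∘tabulate _ j)) ([]=⇒lookup j∈)))

  below-complete : ∀ {i j} → g j < g i → j ∈ below i
  below-complete {i} {j} lt =
    lookup⇒[]= j (below i) (trans (lookup∘tabulate _ j) (to T-≡ (ℕP.<⇒<ᵇ lt)))

  -- Larger letters have strictly more letters below them: i itself is a witness.
  below-⊂ : ∀ {i j} → g i < g j → below i ⊂ below j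
  below-⊂ {i} {j} lt =
    (λ x∈ → below-complete (<-trans (below-sound x∈) lt)) ,
    i , below-complete lt , λ i∈ → <-irrefl refl (below-sound i∈)

  ∣below∣<m : ∀ i → ∣ below i ∣ ℕ.< m
  ∣below∣<m i = subst (∣ below i ∣ ℕ.<_) (∣⊤∣≡n m)
    (p⊂q⇒∣p∣<∣q∣ ((λ _ → ∈⊤) , i , ∈⊤ , λ i∈ → <-irrefl refl (below-sound i∈)))

  rank : Fin m → Fin m
  rank i = fromℕ< (∣below∣<m i)

  rank-mono : ∀ i j → g i < g j → rank i < rank j
  rank-mono i j lt = subst₂ ℕ._<_ (sym (toℕ-fromℕ< _)) (sym (toℕ-fromℕ< _))
    (p⊂q⇒∣p∣<∣q∣ (below-⊂ lt))

  rank-reflects : ∀ i j → rank i < rank j → g i < g j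
  rank-reflects i j r with <-cmp (g i) (g j)
  ... | tri< lt _ _ = lt
  ... | tri≈ _ eq _ rewrite g-inj eq = ⊥-elim (<-irrefl refl r)
  ... | tri> _ _ gt = ⊥-elim (<-asym r (rank-mono j i gt))

  rank-injective : Injective _≡_ _≡_ rank
  rank-injective {i} {j} e with <-cmp (g i) (g j)
  ... | tri< lt _ _ = ⊥-elim (<-irrefl e (rank-mono i j lt))
  ... | tri≈ _ eq _ = g-inj eq
  ... | tri> _ _ gt = ⊥-elim (<-irrefl (sym e) (rank-mono j i gt))

  standardise : Perm
  standardise = perm m rank rank-injective

open Standardisation using (standardise)

subword-occurrence :
  (τ : Perm) {n : ℕ} (p : Fin n → Fin (len τ)) (p-inj : Injective _≡_ _≡_ p) →
  Increasing p →
  (∀ (i j : Fin n) → 1 ≤ toℕ i → toℕ j ≡ suc (toℕ i) → toℕ (p j) ≡ suc (toℕ (p i))) →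
  standardise (val τ ∘ p) (p-inj ∘ inj τ) ≼ τ
subword-occurrence τ {n} p p-inj p-incr p-quasi = record
  { pos = p ; incr = p-incr ; quasi = p-quasi
  ; orderIso = λ i j → mk⇔ (S.rank-reflects i j) (S.rank-mono i j) }
  where module S = Standardisation {n} {len τ} (val τ ∘ p) (p-inj ∘ inj τ)

increasing⇒injective : ∀ {a b} {f : Fin a → Fin b} → Increasing f → Injective _≡_ _≡_ f
increasing⇒injective inc {i} {j} e with <-cmp i j
... | tri< lt _ _ = ⊥-elim (<-irrefl e (inc i j lt))
... | tri≈ _ i≡j _ = i≡j
... | tri> _ _ gt = ⊥-elim (<-irrefl (sym e) (inc j i gt))

occurrence-length : ∀ {σ τ} → σ ≼ τ → len σ ≤ len τ
occurrence-length o = injective⇒≤ (increasing⇒injective (Occurrence.incr o))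

-- An increasing map whose values are all at least c moves the i-th point to
-- at least c + i.  (The offset c makes the induction structural.)
increasing-lower-bound : ∀ {a b} (f : Fin a → Fin b) → Increasing f →
  ∀ c → (∀ j → c ≤ toℕ (f j)) → ∀ i → c + toℕ i ≤ toℕ (f i)
increasing-lower-bound f inc c c≤f zero = subst (_≤ toℕ (f zero)) (sym (ℕP.+-identityʳ c)) (c≤f zero)
increasing-lower-bound f inc c c≤f (suc i) =
  subst (_≤ toℕ (f (suc i))) (sym (ℕP.+-suc c (toℕ i)))
    (increasing-lower-bound (f ∘ suc) (λ i j lt → inc (suc i) (suc j) (s≤s lt)) (suc c)
      (λ j → ℕP.≤-<-trans (c≤f zero) (inc zero (suc j) (s≤s z≤n))) i)

opposite-reverses : ∀ {n} (i j : Fin n) → i < j → opposite j < opposite i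
opposite-reverses i j lt = subst₂ ℕ._<_ (sym (opposite-prop j)) (sym (opposite-prop i))
  (ℕP.∸-monoʳ-< (s≤s lt) (toℕ<n j))

-- An increasing self-map of Fin n is the identity: it moves no point down
-- (lower bound), and by the symmetry i ↦ opposite i it moves no point up.
increasing-endo-id : ∀ {n} (f : Fin n → Fin n) → Increasing f → ∀ i → f i ≡ i
increasing-endo-id {n} f inc i = toℕ-injective (ℕP.≤-antisym not-up not-down)
  where
    not-down : toℕ i ≤ toℕ (f i)
    not-down = increasing-lower-bound f inc 0 (λ _ → z≤n) i

    f° : Fin n → Fin n
    f° = opposite ∘ f ∘ opposite

    f°-inc : Increasing f°
    f°-inc x y lt = opposite-reverses _ _ (inc _ _ (opposite-reverses x y lt))

    mirrored : n ∸ suc (toℕ i) ≤ n ∸ suc (toℕ (f i))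
    mirrored = subst₂ _≤_ (opposite-prop i)
      (trans (cong (toℕ ∘ opposite ∘ f) (opposite-involutive i)) (opposite-prop (f i)))
      (increasing-lower-bound f° f°-inc 0 (λ _ → z≤n) (opposite i))

    not-up : toℕ (f i) ≤ toℕ i
    not-up = ℕP.≤-pred (ℕP.∸-cancelʳ-≤ (toℕ<n (f i)) mirrored)

-- An occurrence between permutations of the same length is the identity on
-- positions, so it can be read backwards.
reverse-occurrence : ∀ {σ τ} → σ ≼ τ → len σ ≡ len τ → τ ≼ σ
reverse-occurrence {perm l _ _} {perm .l w _} o refl = record
  { pos = λ i → i ; incr = λ _ _ lt → lt ; quasi = λ _ _ _ h → h
  ; orderIso = λ i j → mk⇔ (from (iso i j) ∘ subst₂ (λ a b → w a < w b) (sym (fixed i)) (sym (fixed j)))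
                           (subst₂ (λ a b → w a < w b) (fixed i) (fixed j) ∘ to (iso i j)) }
  where
    open Occurrence o renaming (orderIso to iso)
    fixed : ∀ i → pos i ≡ i
    fixed = increasing-endo-id pos incr

covered-if-one-shorter : ∀ {τ ρ} → ρ ≼ τ → suc (len ρ) ≡ len τ → Covers τ ρ
covered-if-one-shorter {τ} {ρ} o e = (o , not-above) , nothing-between
  where
    not-above : ¬ (τ ≼ ρ)
    not-above o' = ℕP.<-irrefl refl (ℕP.≤-trans (ℕP.≤-reflexive e) (occurrence-length o'))
    nothing-between : ¬ (∃[ α ] (ρ ≺ α × α ≺ τ))
    nothing-between (α , (ρ≼α , α⋠ρ) , (α≼τ , τ⋠α)) with ℕP.m≤n⇒m<n∨m≡n (occurrence-length ρ≼α)
    ... | inj₂ eq = α⋠ρ (reverse-occurrence ρ≼α eq)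
    ... | inj₁ lt = τ⋠α (reverse-occurrence α≼τ
                      (ℕP.≤-antisym (occurrence-length α≼τ) (subst (_≤ len α) e lt)))

data Direction : Set where
  increasing decreasing : Direction

Ordered : Direction → ℕ → ℕ → Set
Ordered increasing x y = x ℕ.< y
Ordered decreasing x y = y ℕ.< x

ordered-trans : ∀ d {x y z} → Ordered d x y → Ordered d y z → Ordered d x z
ordered-trans increasing p q = ℕP.<-trans p q
ordered-trans decreasing p q = ℕP.<-trans q p

Monotone : ∀ {a k} → Direction → (Fin a → Fin k) → Set
Monotone d f = ∀ i j → i < j → Ordered d (toℕ (f i)) (toℕ (f j))

monotone-iff : ∀ d {a k} (f : Fin a → Fin k) → Monotone d f →
  ∀ i j → (f i < f j) ⇔ Ordered d (toℕ i) (toℕ j)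
monotone-iff d f mono i j = mk⇔ (reflect d mono) (preserve d mono)
  where
    preserve : ∀ d → Monotone d f → Ordered d (toℕ i) (toℕ j) → f i < f j
    preserve increasing mono lt = mono i j lt
    preserve decreasing mono gt = mono j i gt
    reflect : ∀ d → Monotone d f → f i < f j → Ordered d (toℕ i) (toℕ j)
    reflect d mono lt with <-cmp i j
    reflect increasing mono lt | tri< i<j _ _ = i<j
    reflect decreasing mono lt | tri< i<j _ _ = ⊥-elim (<-asym lt (mono i j i<j))
    reflect d mono lt | tri≈ _ refl _ = ⊥-elim (<-irrefl refl lt)
    reflect increasing mono lt | tri> _ _ j<i = ⊥-elim (<-asym lt (mono j i j<i))
    reflect decreasing mono lt | tri> _ _ j<i = j<i

pattern-monotone : ∀ d {ρ τ} → ρ ≼ τ → Monotone d (val τ) → Monotone d (val ρ)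
pattern-monotone increasing o mono i j lt = from (Occurrence.orderIso o i j) (mono _ _ (Occurrence.incr o i j lt))
pattern-monotone decreasing o mono i j lt = from (Occurrence.orderIso o j i) (mono _ _ (Occurrence.incr o i j lt))

-- A shorter monotone permutation occurs as the prefix of a longer one of
-- the same direction.
monotone-prefix : ∀ d {ρ₁ ρ₂} → Monotone d (val ρ₁) → Monotone d (val ρ₂) →
  len ρ₁ ≤ len ρ₂ → ρ₁ ≼ ρ₂
monotone-prefix d {ρ₁} {ρ₂} mono₁ mono₂ le = record
  { pos = pos ; incr = incr ; quasi = quasi ; orderIso = iso }
  where
    pos : Fin (len ρ₁) → Fin (len ρ₂)
    pos i = inject≤ i le
    same : ∀ i → toℕ (pos i) ≡ toℕ i
    same i = toℕ-inject≤ i le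
    incr : Increasing pos
    incr i j lt = subst₂ ℕ._<_ (sym (same i)) (sym (same j)) lt
    quasi : ∀ (i j : Fin (len ρ₁)) → 1 ≤ toℕ i → toℕ j ≡ suc (toℕ i) → toℕ (pos j) ≡ suc (toℕ (pos i))
    quasi i j _ h = trans (same j) (trans h (cong suc (sym (same i))))
    iso : ∀ i j → (val ρ₁ i < val ρ₁ j) ⇔ (val ρ₂ (pos i) < val ρ₂ (pos j))
    iso i j = ⇔.trans (monotone-iff d (val ρ₁) mono₁ i j)
      (subst₂ (λ a b → Ordered d a b ⇔ (val ρ₂ (pos i) < val ρ₂ (pos j))) (same i) (same j)
        (⇔.sym (monotone-iff d (val ρ₂) mono₂ (pos i) (pos j))))

monotone-comparable : ∀ d {ρ₁ ρ₂} → Monotone d (val ρ₁) → Monotone d (val ρ₂) →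
  (ρ₁ ≼ ρ₂) ⊎ (ρ₂ ≼ ρ₁)
monotone-comparable d {ρ₁} {ρ₂} mono₁ mono₂ with ℕP.≤-total (len ρ₁) (len ρ₂)
... | inj₁ le = inj₁ (monotone-prefix d mono₁ mono₂ le)
... | inj₂ ge = inj₂ (monotone-prefix d mono₂ mono₁ ge)

ShiftInvariant : ∀ {m k} → (Fin (suc m) → Fin k) → Set
ShiftInvariant {m} t = ∀ (x y : Fin m) → t (inject₁ x) < t (inject₁ y) → t (suc x) < t (suc y)

shift-tail : ∀ {m k} (t : Fin (suc (suc m)) → Fin k) → ShiftInvariant t → ShiftInvariant (t ∘ suc)
shift-tail t sh x y = sh (suc x) (suc y)

shift-ordered : ∀ d {m k} (t : Fin (suc m) → Fin k) → ShiftInvariant t → ∀ x y →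
  Ordered d (toℕ (t (inject₁ x))) (toℕ (t (inject₁ y))) → Ordered d (toℕ (t (suc x))) (toℕ (t (suc y)))
shift-ordered increasing t sh x y = sh x y
shift-ordered decreasing t sh x y = sh y x

shift-monotone : ∀ d {m k} (t : Fin (suc (suc m)) → Fin k) → ShiftInvariant t →
  Ordered d (toℕ (t zero)) (toℕ (t (suc zero))) → Monotone d t
shift-monotone d t sh first zero (suc zero) _ = first
shift-monotone d {suc m} t sh first zero (suc (suc j)) _ =
  ordered-trans d first
    (shift-monotone d (t ∘ suc) (shift-tail t sh) (shift-ordered d t sh zero (suc zero) first)
      zero (suc j) (s≤s z≤n))
shift-monotone d {zero} t sh first (suc zero) (suc zero) (s≤s ())
shift-monotone d {suc m} t sh first (suc i) (suc j) (s≤s lt) =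
  shift-monotone d (t ∘ suc) (shift-tail t sh) (shift-ordered d t sh zero (suc zero) first) i j lt

shift-invariant⇒monotone : ∀ {m} (t : Fin (suc m) → Fin (suc m)) → Injective _≡_ _≡_ t →
  ShiftInvariant t → Σ Direction (λ d → Monotone d t)
shift-invariant⇒monotone {zero} t _ _ = increasing , λ { zero zero () }
shift-invariant⇒monotone {suc m} t t-inj sh with <-cmp (t zero) (t (suc zero))
... | tri< lt _ _ = increasing , shift-monotone increasing t sh lt
... | tri≈ _ eq _ = contradiction (t-inj eq) λ ()
... | tri> _ _ gt = decreasing , shift-monotone decreasing t sh gt

≈-common : ∀ {σ τ ρ} → σ ≈ ρ → τ ≈ ρ →
  ∀ (i : Fin (len σ)) (j : Fin (len τ)) → toℕ i ≡ toℕ j → toℕ (val σ i) ≡ toℕ (val τ j)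
≈-common (σρ , σ≈ρ) (τρ , τ≈ρ) i j e =
  trans (σ≈ρ i (cast σρ i) (sym (toℕ-cast σρ i)))
        (sym (τ≈ρ j (cast σρ i) (trans (sym e) (sym (toℕ-cast σρ i)))))

module UniqueCover {m : ℕ} (t : Fin (suc m) → Fin (suc m)) (t-inj : Injective _≡_ _≡_ t) where

  τ : Perm
  τ = perm (suc m) t t-inj

  module First = Standardisation (t ∘ suc) (suc-injective ∘ t-inj)
  module Last = Standardisation (t ∘ inject₁) (inject₁-injective ∘ t-inj)

  dropFirst dropLast : Perm
  dropFirst = First.standardise
  dropLast = Last.standardise

  dropFirst≼τ : dropFirst ≼ τ
  dropFirst≼τ = subword-occurrence τ suc suc-injective (λ _ _ lt → s≤s lt) (λ _ _ _ h → cong suc h)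

  dropLast≼τ : dropLast ≼ τ
  dropLast≼τ = subword-occurrence τ inject₁ inject₁-injective
    (λ i j lt → subst₂ ℕ._<_ (sym (toℕ-inject₁ i)) (sym (toℕ-inject₁ j)) lt)
    (λ i j _ h → trans (toℕ-inject₁ j) (trans h (cong suc (sym (toℕ-inject₁ i)))))

  -- Both deletions are covered by τ, so they coincide, which is shift invariance.
  shift-invariant : CoversExactlyOne τ → ShiftInvariant t
  shift-invariant (ρ , _ , unique) x y lt =
    First.rank-reflects x y (subst₂ ℕ._<_ (same x) (same y) (Last.rank-mono x y lt))
    where
      same : ∀ i → toℕ (val dropLast i) ≡ toℕ (val dropFirst i)
      same i = ≈-common {dropLast} {dropFirst} {ρ} (unique dropLast (covered-if-one-shorter dropLast≼τ refl))
                                                  (unique dropFirst (covered-if-one-shorter dropFirst≼τ refl)) i i refl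

uniquely-covering⇒monotone : (τ : Perm) → CoversExactlyOne τ → Σ Direction (λ d → Monotone d (val τ))
uniquely-covering⇒monotone (perm zero _ _) _ = increasing , λ ()
uniquely-covering⇒monotone (perm (suc m) t t-inj) c =
  shift-invariant⇒monotone t t-inj (UniqueCover.shift-invariant t t-inj c)

-- Everything below τ is monotone in τ's direction, hence any two elements of
-- [σ, τ] are comparable.
proposition4p1 : (τ : Perm) → CoversExactlyOne τ → (σ : Perm) → σ ≼ τ → IsChain σ τ
proposition4p1 τ cover _ _ ρ₁ ρ₂ (_ , ρ₁≼τ) (_ , ρ₂≼τ) with uniquely-covering⇒monotone τ cover
... | d , τ-mono = monotone-comparable d (pattern-monotone d ρ₁≼τ τ-mono) (pattern-monotone d ρ₂≼τ τ-mono)
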